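{- Let $\mathcal{L}$ be a Calculus of Algebraic Constructions whose conversion rule uses $\downarrow_{\beta\mathcal{R}}$, and let $\mathcal{L}'$ be the same calculus except that its conversion rule uses $\downarrow_\beta\cup\downarrow_{\mathcal{R}}$. If $\to_{\beta\mathcal{R}}$ has the subject reduction property in $\mathcal{L}'$ (i.e. $\Gamma\vdash' t:T$ and $t\to_{\beta\mathcal{R}}t'$ imply $\Gamma\vdash' t':T$), then the typing relations of $\mathcal{L}$ and $\mathcal{L}'$ coincide (and hence $\to_{\beta\mathcal{R}}$ also has the subject reduction property in $\mathcal{L}$).
   Context: Terms: sorts $\star,\Box$; an infinite countable set of variables, each variable $x$ having a sort $s_x\in\{\star,\Box\}$ (infinitely many of each); a countable set $\mathcal{F}$ of symbols. Terms $t ::= s \mid x \mid f \mid [x:t]t \mid (x:t)t \mid t\,t$ up to $\alpha$-equivalence. $\to_\beta$: closure under context and substitution of $[x:U]v\,u\to v\{x\mapsto u\}$. Rewrite rules $l\to r$: $l$ algebraic (built from variables and applications $f\,t_1\ldots t_k$), not a variable, $\mathrm{FV}(r)\subseteq\mathrm{FV}(l)$; $\to_{\mathcal{R}}$ closure of a rule set $\mathcal{R}$ under substitution and context; $\to_{\beta\mathcal{R}}=\to_\beta\cup\to_{\mathcal{R}}$. For a relation $\to_a$, $T\downarrow_a T'$ means $T\to_a^*V$ and $T'\to_a^*V$ for some $V$. Each symbol $f$ has a sort $s_f$ and closed type $\tau_f=(x_1:T_1)\ldots(x_n:T_n)U$, with every rule $f\,l_1\ldots l_k\to r$ having $k\le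 n$, and it is assumed that $\vdash\tau_f:s_f$. A Calculus of Algebraic Constructions with conversion relation $\approx$ has typing relation $\Gamma\vdash t:T$ defined as the smallest relation closed under ($s,s'\in\{\star,\Box\}$): (ax) $\vdash\star:\Box$; (symb) if $\vdash\tau_f:s_f$ then $\vdash f:\tau_f$; (var) if $\Gamma\vdash T:s_x$, $x\notin\mathrm{dom}(\Gamma)$ then $\Gamma,x:T\vdash x:T$; (weak) if $\Gamma\vdash t:T$, $\Gamma\vdash U:s_x$, $x\notin\mathrm{dom}(\Gamma)$ then $\Gamma,x:U\vdash t:T$; (prod) if $\Gamma\vdash U:s$, $\Gamma,x:U\vdash V:s'$ then $\Gamma\vdash(x:U)V:s'$; (abs) if $\Gamma,x:U\vdash v:V$, $\Gamma\vdash(x:U)V:s$ then $\Gamma\vdash[x:U]v:(x:U)V$; (app) if $\Gamma\vdash t:(x:U)V$, $\Gamma\vdash u:U$ then $\Gamma\vdash t\,u:V\{x\mapsto u\}$; (conv) if $\Gamma\vdash t:T$, $\Gamma\vdash T':s'$ and $T\approx T'$ then $\Gamma\vdash t:T'$. $\vdash$ and $\vdash'$ denote the typing relations of $\mathcal{L}$ and $\mathcal{L}'$. -}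

module Defs where

open import Data.Nat using (ℕ; zero; suc; _≤_)
open import Data.List using (List; []; _∷_)
open import Data.Product using (Σ; ∃; _×_; _,_)
open import Data.Sum using (_⊎_)
open import Relation.Nullary using (¬_)
open import Relation.Binary.PropositionalEquality using (_≡_)
open import Relation.Binary.Construct.Closure.ReflexiveTransitive using (Star)

data Sort : Set where
  ⋆ □ : Sort

-- Terms up to α-equivalence, in de Bruijn form.  Binders record the sort
-- s_x of the bound variable (variables of each sort are unlimited).

data Term (Sym : Set) : Set where
  srt : Sort → Term Sym
  var : ℕ → Term Sym
  sym : Sym → Term Sym
  lam : Sort → Term Sym → Term Sym → Term Sym
  pi  : Sort → Term Sym → Term Sym → Term Sym
  app : Term Sym → Term Sym → Term Sym

module _ {Sym : Set} where

  ext : (ℕ → ℕ) → ℕ → ℕ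
  ext ρ zero    = zero
  ext ρ (suc n) = suc (ρ n)

  rename : (ℕ → ℕ) → Term Sym → Term Sym
  rename ρ (srt s)     = srt s
  rename ρ (var n)     = var (ρ n)
  rename ρ (sym f)     = sym f
  rename ρ (lam s A b) = lam s (rename ρ A) (rename (ext ρ) b)
  rename ρ (pi s A B)  = pi s (rename ρ A) (rename (ext ρ) B)
  rename ρ (app t u)   = app (rename ρ t) (rename ρ u)

  shift : Term Sym → Term Sym
  shift = rename suc

  exts : (ℕ → Term Sym) → ℕ → Term Sym
  exts σ zero    = var zero
  exts σ (suc n) = shift (σ n)

  subst : (ℕ → Term Sym) → Term Sym → Term Sym
  subst σ (srt s)     = srt s
  subst σ (var n)     = σ n
  subst σ (sym f)     = sym f
  subst σ (lam s A b) = lam s (subst σ A) (subst (exts σ) b)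
  subst σ (pi s A B)  = pi s (subst σ A) (subst (exts σ) B)
  subst σ (app t u)   = app (subst σ t) (subst σ u)

  _[_] : Term Sym → Term Sym → Term Sym
  b [ u ] = subst σ b
    where
    σ : ℕ → Term Sym
    σ zero    = u
    σ (suc n) = var n

  data FreeIn : ℕ → Term Sym → Set where
    fvar  : ∀ {n} → FreeIn n (var n)
    flamA : ∀ {n s A b} → FreeIn n A → FreeIn n (lam s A b)
    flamb : ∀ {n s A b} → FreeIn (suc n) b → FreeIn n (lam s A b)
    fpiA  : ∀ {n s A B} → FreeIn n A → FreeIn n (pi s A B)
    fpiB  : ∀ {n s A B} → FreeIn (suc n) B → FreeIn n (pi s A B)
    fappl : ∀ {n t u} → FreeIn n t → FreeIn n (app t u)
    fappr : ∀ {n t u} → FreeIn n u → FreeIn n (app t u)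

  Closed : Term Sym → Set
  Closed t = ∀ n → ¬ FreeIn n t

  piDepth : Term Sym → ℕ
  piDepth (pi s A B) = suc (piDepth B)
  piDepth _          = zero

  data Compat (H : Term Sym → Term Sym → Set) : Term Sym → Term Sym → Set where
    head  : ∀ {t t'} → H t t' → Compat H t t'
    lamA  : ∀ {s A A' b} → Compat H A A' → Compat H (lam s A b) (lam s A' b)
    lamb  : ∀ {s A b b'} → Compat H b b' → Compat H (lam s A b) (lam s A b')
    piA   : ∀ {s A A' B} → Compat H A A' → Compat H (pi s A B) (pi s A' B)
    piB   : ∀ {s A B B'} → Compat H B B' → Compat H (pi s A B) (pi s A B')
    appl  : ∀ {t t' u} → Compat H t t' → Compat H (app t u) (app t' u)
    appr  : ∀ {t u u'} → Compat H u u' → Compat H (app t u) (app t u')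

  data BetaHead : Term Sym → Term Sym → Set where
    beta : ∀ {s U v u} → BetaHead (app (lam s U v) u) (v [ u ])

  _→β_ : Term Sym → Term Sym → Set
  _→β_ = Compat BetaHead

  data RHead (R : Term Sym → Term Sym → Set) : Term Sym → Term Sym → Set where
    rule : ∀ {l r} → R l r → (σ : ℕ → Term Sym) → RHead R (subst σ l) (subst σ r)

  _⊢_→R_ : (Term Sym → Term Sym → Set) → Term Sym → Term Sym → Set
  R ⊢ t →R t' = Compat (RHead R) t t'

  _⊢_→βR_ : (Term Sym → Term Sym → Set) → Term Sym → Term Sym → Set
  R ⊢ t →βR t' = (t →β t') ⊎ (R ⊢ t →R t')

  Join : (Term Sym → Term Sym → Set) → Term Sym → Term Sym → Set
  Join _⇒_ T T' = ∃ λ V → Star _⇒_ T V × Star _⇒_ T' V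

  mutual
    data Spine (f : Sym) : ℕ → Term Sym → Set where
      s0 : Spine f zero (sym f)
      sS : ∀ {k t u} → Spine f k t → Alg u → Spine f (suc k) (app t u)

    data Alg : Term Sym → Set where
      avar : ∀ {n} → Alg (var n)
      afun : ∀ {f k t} → Spine f k t → Alg t

  IsVar : Term Sym → Set
  IsVar t = ∃ λ n → t ≡ var n

  WellFormedRules : (Sym → Term Sym) → (Term Sym → Term Sym → Set) → Set
  WellFormedRules τ R = ∀ {l r} → R l r →
      Alg l
    × ¬ IsVar l
    × (∀ n → FreeIn n r → FreeIn n l)
    × (∀ f k → Spine f k l → k ≤ piDepth (τ f))

  -- typing contexts: the head of the list is the most recent variable
  -- (de Bruijn index 0); each entry records the sort s_x and the type.
  Ctx : Set
  Ctx = List (Sort × Term Sym)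

  data Typing (τ : Sym → Term Sym) (sf : Sym → Sort)
              (_≈_ : Term Sym → Term Sym → Set)
              : Ctx → Term Sym → Term Sym → Set where
    ax   : Typing τ sf _≈_ [] (srt ⋆) (srt □)
    symb : ∀ {f} → Typing τ sf _≈_ [] (τ f) (srt (sf f))
         → Typing τ sf _≈_ [] (sym f) (τ f)
    var  : ∀ {Γ T sx} → Typing τ sf _≈_ Γ T (srt sx)
         → Typing τ sf _≈_ ((sx , T) ∷ Γ) (var zero) (shift T)
    weak : ∀ {Γ t T U sx} → Typing τ sf _≈_ Γ t T → Typing τ sf _≈_ Γ U (srt sx)
         → Typing τ sf _≈_ ((sx , U) ∷ Γ) (shift t) (shift T)
    prod : ∀ {Γ U V sx s s'} → Typing τ sf _≈_ Γ U (srt s)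
         → Typing τ sf _≈_ ((sx , U) ∷ Γ) V (srt s')
         → Typing τ sf _≈_ Γ (pi sx U V) (srt s')
    abs  : ∀ {Γ U v V sx s} → Typing τ sf _≈_ ((sx , U) ∷ Γ) v V
         → Typing τ sf _≈_ Γ (pi sx U V) (srt s)
         → Typing τ sf _≈_ Γ (lam sx U v) (pi sx U V)
    appT : ∀ {Γ t u U V sx} → Typing τ sf _≈_ Γ t (pi sx U V)
         → Typing τ sf _≈_ Γ u U
         → Typing τ sf _≈_ Γ (app t u) (V [ u ])
    conv : ∀ {Γ t T T' s'} → Typing τ sf _≈_ Γ t T
         → Typing τ sf _≈_ Γ T' (srt s') → T ≈ T'
         → Typing τ sf _≈_ Γ t T'

  ConvβR : (Term Sym → Term Sym → Set) → Term Sym → Term Sym → Set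
  ConvβR R = Join (R ⊢_→βR_)

  Convβ∪R : (Term Sym → Term Sym → Set) → Term Sym → Term Sym → Set
  Convβ∪R R T T' = Join _→β_ T T' ⊎ Join (R ⊢_→R_) T T'

{-# OPTIONS --safe #-}
module Submission where

open import Defs
open import Data.Nat using (ℕ; zero; suc)
open import Data.List using ([]; _∷_; _++_; length)
open import Data.Product using (_×_; _,_; ∃)
open import Data.Sum using (_⊎_; inj₁; inj₂; [_,_])
open import Function using (_∘_)
open import Function.Bundles using (_↣_; _⇔_; mk⇔)
open import Data.Empty using (⊥-elim)
open import Relation.Nullary using (¬_)
open import Relation.Binary.PropositionalEquality as ≡ using (_≡_; _≢_; refl; cong; cong₂; _≗_)
open import Relation.Binary.Construct.Closure.ReflexiveTransitive as Star using (Star; ε; _◅_; gmap)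

-- A conversion T ↓βR T′ of L, say T ↠ V ↞ T′, is replayed in L′ as a chain of one-step
-- conversions T → … → V ← … ← T′, each of them a ↓β or a ↓R.  The rule (conv) needs every
-- intermediate type to be typable, and subject reduction in L′ propagates this from T and T′:
-- T′ is typable by the premise of (conv), and T by type correctness of L′ unless T = □,
-- which is →βR-normal because rule left-hand sides are neither variables nor sorts.
-- The converse inclusion holds because ↓β ∪ ↓R ⊆ ↓βR.

module _ {Sym : Set} where

  ext-cong : ∀ {ρ ρ′ : ℕ → ℕ} → ρ ≗ ρ′ → ext {Sym} ρ ≗ ext {Sym} ρ′
  ext-cong e zero    = refl
  ext-cong e (suc n) = cong suc (e n)

  rename-cong : ∀ {ρ ρ′ : ℕ → ℕ} → ρ ≗ ρ′ → (t : Term Sym) → rename ρ t ≡ rename ρ′ t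
  rename-cong e (srt s)     = refl
  rename-cong e (var n)     = cong var (e n)
  rename-cong e (sym f)     = refl
  rename-cong e (lam s A b) = cong₂ (lam s) (rename-cong e A) (rename-cong (ext-cong e) b)
  rename-cong e (pi s A B)  = cong₂ (pi s) (rename-cong e A) (rename-cong (ext-cong e) B)
  rename-cong e (app t u)   = cong₂ app (rename-cong e t) (rename-cong e u)

  exts-cong : ∀ {σ σ′ : ℕ → Term Sym} → σ ≗ σ′ → exts σ ≗ exts σ′
  exts-cong e zero    = refl
  exts-cong e (suc n) = cong shift (e n)

  subst-cong : ∀ {σ σ′ : ℕ → Term Sym} → σ ≗ σ′ → (t : Term Sym) → subst σ t ≡ subst σ′ t
  subst-cong e (srt s)     = refl
  subst-cong e (var n)     = e n
  subst-cong e (sym f)     = refl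
  subst-cong e (lam s A b) = cong₂ (lam s) (subst-cong e A) (subst-cong (exts-cong e) b)
  subst-cong e (pi s A B)  = cong₂ (pi s) (subst-cong e A) (subst-cong (exts-cong e) B)
  subst-cong e (app t u)   = cong₂ app (subst-cong e t) (subst-cong e u)

  ext-ext : ∀ (ρ ρ′ : ℕ → ℕ) → ext {Sym} ρ ∘ ext {Sym} ρ′ ≗ ext {Sym} (ρ ∘ ρ′)
  ext-ext ρ ρ′ zero    = refl
  ext-ext ρ ρ′ (suc n) = refl

  rename-rename : ∀ (ρ ρ′ : ℕ → ℕ) (t : Term Sym) → rename ρ (rename ρ′ t) ≡ rename (ρ ∘ ρ′) t
  rename-rename ρ ρ′ (srt s)     = refl
  rename-rename ρ ρ′ (var n)     = refl
  rename-rename ρ ρ′ (sym f)     = refl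
  rename-rename ρ ρ′ (lam s A b) = cong₂ (lam s) (rename-rename ρ ρ′ A)
    (≡.trans (rename-rename (ext {Sym} ρ) (ext {Sym} ρ′) b) (rename-cong (ext-ext ρ ρ′) b))
  rename-rename ρ ρ′ (pi s A B)  = cong₂ (pi s) (rename-rename ρ ρ′ A)
    (≡.trans (rename-rename (ext {Sym} ρ) (ext {Sym} ρ′) B) (rename-cong (ext-ext ρ ρ′) B))
  rename-rename ρ ρ′ (app t u)   = cong₂ app (rename-rename ρ ρ′ t) (rename-rename ρ ρ′ u)

  rename-ext-shift : ∀ (ρ : ℕ → ℕ) (A : Term Sym) → rename (ext {Sym} ρ) (shift A) ≡ shift (rename ρ A)
  rename-ext-shift ρ A = ≡.trans (rename-rename (ext {Sym} ρ) suc A) (≡.sym (rename-rename suc ρ A))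

  exts-ext : ∀ (σ : ℕ → Term Sym) (ρ : ℕ → ℕ) → exts σ ∘ ext {Sym} ρ ≗ exts (σ ∘ ρ)
  exts-ext σ ρ zero    = refl
  exts-ext σ ρ (suc n) = refl

  subst-rename : ∀ (σ : ℕ → Term Sym) (ρ : ℕ → ℕ) (t : Term Sym) → subst σ (rename ρ t) ≡ subst (σ ∘ ρ) t
  subst-rename σ ρ (srt s)     = refl
  subst-rename σ ρ (var n)     = refl
  subst-rename σ ρ (sym f)     = refl
  subst-rename σ ρ (lam s A b) = cong₂ (lam s) (subst-rename σ ρ A)
    (≡.trans (subst-rename (exts σ) (ext {Sym} ρ) b) (subst-cong (exts-ext σ ρ) b))
  subst-rename σ ρ (pi s A B)  = cong₂ (pi s) (subst-rename σ ρ A)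
    (≡.trans (subst-rename (exts σ) (ext {Sym} ρ) B) (subst-cong (exts-ext σ ρ) B))
  subst-rename σ ρ (app t u)   = cong₂ app (subst-rename σ ρ t) (subst-rename σ ρ u)

  rename-exts : ∀ (ρ : ℕ → ℕ) (σ : ℕ → Term Sym) → rename (ext {Sym} ρ) ∘ exts σ ≗ exts (rename ρ ∘ σ)
  rename-exts ρ σ zero    = refl
  rename-exts ρ σ (suc n) = rename-ext-shift ρ (σ n)

  rename-subst : ∀ (ρ : ℕ → ℕ) (σ : ℕ → Term Sym) (t : Term Sym)
    → rename ρ (subst σ t) ≡ subst (rename ρ ∘ σ) t
  rename-subst ρ σ (srt s)     = refl
  rename-subst ρ σ (var n)     = refl
  rename-subst ρ σ (sym f)     = refl
  rename-subst ρ σ (lam s A b) = cong₂ (lam s) (rename-subst ρ σ A)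
    (≡.trans (rename-subst (ext {Sym} ρ) (exts σ) b) (subst-cong (rename-exts ρ σ) b))
  rename-subst ρ σ (pi s A B)  = cong₂ (pi s) (rename-subst ρ σ A)
    (≡.trans (rename-subst (ext {Sym} ρ) (exts σ) B) (subst-cong (rename-exts ρ σ) B))
  rename-subst ρ σ (app t u)   = cong₂ app (rename-subst ρ σ t) (rename-subst ρ σ u)

  subst-exts-shift : ∀ (σ : ℕ → Term Sym) (A : Term Sym) → subst (exts σ) (shift A) ≡ shift (subst σ A)
  subst-exts-shift σ A = ≡.trans (subst-rename (exts σ) suc A) (≡.sym (rename-subst suc σ A))

  subst-exts : ∀ (σ σ′ : ℕ → Term Sym) → subst (exts σ) ∘ exts σ′ ≗ exts (subst σ ∘ σ′)
  subst-exts σ σ′ zero    = refl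
  subst-exts σ σ′ (suc n) = subst-exts-shift σ (σ′ n)

  subst-subst : ∀ (σ σ′ : ℕ → Term Sym) (t : Term Sym) → subst σ (subst σ′ t) ≡ subst (subst σ ∘ σ′) t
  subst-subst σ σ′ (srt s)     = refl
  subst-subst σ σ′ (var n)     = refl
  subst-subst σ σ′ (sym f)     = refl
  subst-subst σ σ′ (lam s A b) = cong₂ (lam s) (subst-subst σ σ′ A)
    (≡.trans (subst-subst (exts σ) (exts σ′) b) (subst-cong (subst-exts σ σ′) b))
  subst-subst σ σ′ (pi s A B)  = cong₂ (pi s) (subst-subst σ σ′ A)
    (≡.trans (subst-subst (exts σ) (exts σ′) B) (subst-cong (subst-exts σ σ′) B))
  subst-subst σ σ′ (app t u)   = cong₂ app (subst-subst σ σ′ t) (subst-subst σ σ′ u)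

  exts-var : exts {Sym} var ≗ var
  exts-var zero    = refl
  exts-var (suc n) = refl

  subst-var : (t : Term Sym) → subst var t ≡ t
  subst-var (srt s)     = refl
  subst-var (var n)     = refl
  subst-var (sym f)     = refl
  subst-var (lam s A b) = cong₂ (lam s) (subst-var A) (≡.trans (subst-cong exts-var b) (subst-var b))
  subst-var (pi s A B)  = cong₂ (pi s) (subst-var A) (≡.trans (subst-cong exts-var B) (subst-var B))
  subst-var (app t u)   = cong₂ app (subst-var t) (subst-var u)

  ren : (ℕ → ℕ) → ℕ → Term Sym
  ren ρ n = var (ρ n)

  ren-ext : ∀ (ρ : ℕ → ℕ) → ren (ext {Sym} ρ) ≗ exts (ren ρ)
  ren-ext ρ zero    = refl
  ren-ext ρ (suc n) = refl

  rename-as-subst : ∀ (ρ : ℕ → ℕ) (t : Term Sym) → rename ρ t ≡ subst (ren ρ) t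
  rename-as-subst ρ (srt s)     = refl
  rename-as-subst ρ (var n)     = refl
  rename-as-subst ρ (sym f)     = refl
  rename-as-subst ρ (lam s A b) = cong₂ (lam s) (rename-as-subst ρ A)
    (≡.trans (rename-as-subst (ext {Sym} ρ) b) (subst-cong (ren-ext ρ) b))
  rename-as-subst ρ (pi s A B)  = cong₂ (pi s) (rename-as-subst ρ A)
    (≡.trans (rename-as-subst (ext {Sym} ρ) B) (subst-cong (ren-ext ρ) B))
  rename-as-subst ρ (app t u)   = cong₂ app (rename-as-subst ρ t) (rename-as-subst ρ u)

  single : Term Sym → ℕ → Term Sym
  single u zero    = u
  single u (suc n) = var n

  []-as-subst : (b u : Term Sym) → b [ u ] ≡ subst (single u) b
  []-as-subst b u = subst-cong (λ { zero → refl ; (suc n) → refl }) b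

  subst-single-shift : (u t : Term Sym) → subst (single u) (shift t) ≡ t
  subst-single-shift u t = ≡.trans (subst-rename (single u) suc t) (subst-var t)

  subst-[] : ∀ (σ : ℕ → Term Sym) (v u : Term Sym) → subst σ (v [ u ]) ≡ subst (exts σ) v [ subst σ u ]
  subst-[] σ v u = begin
    subst σ (v [ u ])                               ≡⟨ cong (subst σ) ([]-as-subst v u) ⟩
    subst σ (subst (single u) v)                    ≡⟨ subst-subst σ (single u) v ⟩
    subst (subst σ ∘ single u) v                    ≡⟨ subst-cong commute v ⟩
    subst (subst (single (subst σ u)) ∘ exts σ) v   ≡⟨ subst-subst (single (subst σ u)) (exts σ) v ⟨
    subst (single (subst σ u)) (subst (exts σ) v)   ≡⟨ []-as-subst (subst (exts σ) v) (subst σ u) ⟨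
    subst (exts σ) v [ subst σ u ]                  ∎
    where
    open ≡.≡-Reasoning
    commute : subst σ ∘ single u ≗ subst (single (subst σ u)) ∘ exts σ
    commute zero    = refl
    commute (suc n) = ≡.sym (subst-single-shift (subst σ u) (σ n))

  rename-[] : ∀ (ρ : ℕ → ℕ) (v u : Term Sym) → rename ρ (v [ u ]) ≡ rename (ext {Sym} ρ) v [ rename ρ u ]
  rename-[] ρ v u = begin
    rename ρ (v [ u ])                          ≡⟨ rename-as-subst ρ (v [ u ]) ⟩
    subst (ren ρ) (v [ u ])                     ≡⟨ subst-[] (ren ρ) v u ⟩
    subst (exts (ren ρ)) v [ subst (ren ρ) u ]  ≡⟨ cong (_[ subst (ren ρ) u ]) (subst-cong (ren-ext ρ) v) ⟨
    subst (ren ρ⁺) v [ subst (ren ρ) u ]        ≡⟨ cong₂ _[_] (rename-as-subst ρ⁺ v) (rename-as-subst ρ u) ⟨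
    rename ρ⁺ v [ rename ρ u ]                  ∎
    where
    open ≡.≡-Reasoning
    ρ⁺ : ℕ → ℕ
    ρ⁺ = ext {Sym} ρ

  extⁿ : ℕ → (ℕ → ℕ) → ℕ → ℕ
  extⁿ zero    ρ = ρ
  extⁿ (suc k) ρ = ext {Sym} (extⁿ k ρ)

  extsⁿ : ℕ → (ℕ → Term Sym) → ℕ → Term Sym
  extsⁿ zero    σ = σ
  extsⁿ (suc k) σ = exts (extsⁿ k σ)

  renameCtx : (ℕ → ℕ) → Ctx {Sym} → Ctx {Sym}
  renameCtx ρ []            = []
  renameCtx ρ ((s , A) ∷ Δ) = (s , rename (extⁿ (length Δ) ρ) A) ∷ renameCtx ρ Δ

  substCtx : (ℕ → Term Sym) → Ctx {Sym} → Ctx {Sym}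
  substCtx σ []            = []
  substCtx σ ((s , A) ∷ Δ) = (s , subst (extsⁿ (length Δ) σ) A) ∷ substCtx σ Δ

module _ {Sym : Set} where

  SubstStable : (Term Sym → Term Sym → Set) → Set
  SubstStable H = ∀ (σ : ℕ → Term Sym) {a b} → H a b → H (subst σ a) (subst σ b)

  Compat-subst : ∀ {H} → SubstStable H → SubstStable (Compat H)
  Compat-subst h σ (head x) = head (h σ x)
  Compat-subst h σ (lamA c) = lamA (Compat-subst h σ c)
  Compat-subst h σ (lamb c) = lamb (Compat-subst h (exts σ) c)
  Compat-subst h σ (piA c)  = piA (Compat-subst h σ c)
  Compat-subst h σ (piB c)  = piB (Compat-subst h (exts σ) c)
  Compat-subst h σ (appl c) = appl (Compat-subst h σ c)
  Compat-subst h σ (appr c) = appr (Compat-subst h σ c)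

  Join-subst : ∀ {H} → SubstStable H → SubstStable (Join H)
  Join-subst h σ (V , p , q) = subst σ V , gmap (subst σ) (h σ) p , gmap (subst σ) (h σ) q

  Join-map : ∀ {H H′ : Term Sym → Term Sym → Set} → (∀ {a b} → H a b → H′ a b)
    → ∀ {a b} → Join H a b → Join H′ a b
  Join-map f (V , p , q) = V , Star.map f p , Star.map f q

  Join-sym : ∀ {H : Term Sym → Term Sym → Set} {a b} → Join H a b → Join H b a
  Join-sym (V , p , q) = V , q , p

  BetaHead-subst : SubstStable BetaHead
  BetaHead-subst σ (beta {v = v} {u = u}) = ≡.subst (BetaHead _) (≡.sym (subst-[] σ v u)) beta

  module _ (R : Term Sym → Term Sym → Set) where

    RHead-subst : SubstStable (RHead R)
    RHead-subst σ (rule {l} {r} lr ρ) =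
      ≡.subst₂ (RHead R) (≡.sym (subst-subst σ ρ l)) (≡.sym (subst-subst σ ρ r)) (rule lr (subst σ ∘ ρ))

    Convβ∪R-subst : SubstStable (Convβ∪R R)
    Convβ∪R-subst σ (inj₁ j) = inj₁ (Join-subst (Compat-subst BetaHead-subst) σ j)
    Convβ∪R-subst σ (inj₂ j) = inj₂ (Join-subst (Compat-subst RHead-subst) σ j)

    Convβ∪R⇒ConvβR : ∀ {A B} → Convβ∪R R A B → ConvβR R A B
    Convβ∪R⇒ConvβR = [ Join-map inj₁ , Join-map inj₂ ]

    →βR⇒Convβ∪R : ∀ {A B} → R ⊢ A →βR B → Convβ∪R R A B
    →βR⇒Convβ∪R (inj₁ st) = inj₁ (_ , st ◅ ε , ε)
    →βR⇒Convβ∪R (inj₂ st) = inj₂ (_ , st ◅ ε , ε)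

    Convβ∪R-sym : ∀ {A B} → Convβ∪R R A B → Convβ∪R R B A
    Convβ∪R-sym = [ inj₁ ∘ Join-sym , inj₂ ∘ Join-sym ]

    algebraic-subst-not-sort : ∀ {l} → Alg l → ¬ IsVar l → ∀ (σ : ℕ → Term Sym) {s} → subst σ l ≢ srt s
    algebraic-subst-not-sort avar            notVar σ _ = notVar (_ , refl)
    algebraic-subst-not-sort (afun s0)       _      σ ()
    algebraic-subst-not-sort (afun (sS _ _)) _      σ ()

    sort-normal : ∀ {τ : Sym → Term Sym} → WellFormedRules τ R → ∀ {s t} → ¬ (R ⊢ srt s →βR t)
    sort-normal wf (inj₁ (head ()))
    sort-normal wf (inj₂ (head h)) = rule-lhs-not-sort h refl
      where
      rule-lhs-not-sort : ∀ {a b s} → RHead R a b → a ≢ srt s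
      rule-lhs-not-sort (rule lr σ) = let alg , notVar , _ = wf lr
                                      in algebraic-subst-not-sort alg notVar σ

    sort-↠ : ∀ {τ : Sym → Term Sym} → WellFormedRules τ R
      → ∀ {s V} → Star (R ⊢_→βR_) (srt s) V → V ≡ srt s
    sort-↠ wf ε        = refl
    sort-↠ wf (st ◅ _) = ⊥-elim (sort-normal wf st)

Typing-map : ∀ {Sym : Set} {τ : Sym → Term Sym} {sf : Sym → Sort} {_≈_ _≈′_ : Term Sym → Term Sym → Set}
  → (∀ {A B} → A ≈ B → A ≈′ B) → ∀ {Γ t T} → Typing τ sf _≈_ Γ t T → Typing τ sf _≈′_ Γ t T
Typing-map f ax           = ax
Typing-map f (symb P)     = symb (Typing-map f P)
Typing-map f (var P)      = var (Typing-map f P)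
Typing-map f (weak D P)   = weak (Typing-map f D) (Typing-map f P)
Typing-map f (prod P Q)   = prod (Typing-map f P) (Typing-map f Q)
Typing-map f (abs D P)    = abs (Typing-map f D) (Typing-map f P)
Typing-map f (appT D E)   = appT (Typing-map f D) (Typing-map f E)
Typing-map f (conv D P c) = conv (Typing-map f D) (Typing-map f P) (f c)

module TypingLemmas {Sym : Set} (τ : Sym → Term Sym) (sf : Sym → Sort)
  (_≈_ : Term Sym → Term Sym → Set)
  (≈-subst : SubstStable _≈_) where

  infix 4 _⊢_∶_
  _⊢_∶_ : Ctx {Sym} → Term Sym → Term Sym → Set
  Γ ⊢ t ∶ T = Typing τ sf _≈_ Γ t T

  ⊢-cast : ∀ {Γ t t′ T T′} → t′ ≡ t → T′ ≡ T → Γ ⊢ t ∶ T → Γ ⊢ t′ ∶ T′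
  ⊢-cast refl refl D = D

  ≈-rename : ∀ (ρ : ℕ → ℕ) {A B} → A ≈ B → rename ρ A ≈ rename ρ B
  ≈-rename ρ {A} {B} A≈B =
    ≡.subst₂ _≈_ (≡.sym (rename-as-subst ρ A)) (≡.sym (rename-as-subst ρ B)) (≈-subst (ren ρ) A≈B)

  weakening : ∀ {Γ′ t T} → Γ′ ⊢ t ∶ T → ∀ Δ {Γ sw W} → Γ′ ≡ Δ ++ Γ → Γ ⊢ W ∶ srt sw
    → let ρ = extⁿ {Sym} (length Δ) suc in renameCtx suc Δ ++ (sw , W) ∷ Γ ⊢ rename ρ t ∶ rename ρ T
  weakening D [] refl ⊢W = weak D ⊢W
  weakening ax (_ ∷ Δ) () ⊢W
  weakening (symb _) (_ ∷ Δ) () ⊢W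
  weakening (var {T = A} P) ((s , .A) ∷ Δ) refl ⊢W =
    ⊢-cast refl (rename-ext-shift (extⁿ {Sym} (length Δ) suc) A) (var (weakening P Δ refl ⊢W))
  weakening (weak {t = t} {T = T} {U = A} D P) ((s , .A) ∷ Δ) refl ⊢W =
    ⊢-cast (rename-ext-shift (extⁿ {Sym} (length Δ) suc) t)
           (rename-ext-shift (extⁿ {Sym} (length Δ) suc) T)
      (weak (weakening D Δ refl ⊢W) (weakening P Δ refl ⊢W))
  weakening (prod {U = U} {sx = sx} P Q) Δ@(_ ∷ _) refl ⊢W =
    prod (weakening P Δ refl ⊢W) (weakening Q ((sx , U) ∷ Δ) refl ⊢W)
  weakening (abs {U = U} {sx = sx} D P) Δ@(_ ∷ _) refl ⊢W =
    abs (weakening D ((sx , U) ∷ Δ) refl ⊢W) (weakening P Δ refl ⊢W)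
  weakening (appT {u = u} {V = V} D E) Δ@(_ ∷ _) refl ⊢W =
    ⊢-cast refl (rename-[] (extⁿ {Sym} (length Δ) suc) V u)
      (appT (weakening D Δ refl ⊢W) (weakening E Δ refl ⊢W))
  weakening (conv D P c) Δ@(_ ∷ _) refl ⊢W =
    conv (weakening D Δ refl ⊢W) (weakening P Δ refl ⊢W) (≈-rename _ c)

  substitution : ∀ {Γ′ t T} → Γ′ ⊢ t ∶ T → ∀ Δ {Γ sx U u} → Γ′ ≡ Δ ++ (sx , U) ∷ Γ → Γ ⊢ u ∶ U
    → let σ = extsⁿ (length Δ) (single u) in substCtx (single u) Δ ++ Γ ⊢ subst σ t ∶ subst σ T
  substitution ax [] () ⊢u
  substitution ax (_ ∷ Δ) () ⊢u
  substitution (symb _) [] () ⊢u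
  substitution (symb _) (_ ∷ Δ) () ⊢u
  substitution (var {T = A} P) [] {u = u} refl ⊢u =
    ⊢-cast refl (subst-single-shift u A) ⊢u
  substitution (var {T = A} P) ((s , .A) ∷ Δ) {u = u} refl ⊢u =
    ⊢-cast refl (subst-exts-shift (extsⁿ (length Δ) (single u)) A) (var (substitution P Δ refl ⊢u))
  substitution (weak {t = t} {T = T} D P) [] {u = u} refl ⊢u =
    ⊢-cast (subst-single-shift u t) (subst-single-shift u T) D
  substitution (weak {t = t} {T = T} {U = A} D P) ((s , .A) ∷ Δ) {u = u} refl ⊢u =
    ⊢-cast (subst-exts-shift (extsⁿ (length Δ) (single u)) t)
           (subst-exts-shift (extsⁿ (length Δ) (single u)) T)
      (weak (substitution D Δ refl ⊢u) (substitution P Δ refl ⊢u))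
  substitution (prod {U = U} {sx = sx} P Q) Δ refl ⊢u =
    prod (substitution P Δ refl ⊢u) (substitution Q ((sx , U) ∷ Δ) refl ⊢u)
  substitution (abs {U = U} {sx = sx} D P) Δ refl ⊢u =
    abs (substitution D ((sx , U) ∷ Δ) refl ⊢u) (substitution P Δ refl ⊢u)
  substitution (appT {u = v} {V = V} D E) Δ {u = u} refl ⊢u =
    ⊢-cast refl (subst-[] (extsⁿ (length Δ) (single u)) V v)
      (appT (substitution D Δ refl ⊢u) (substitution E Δ refl ⊢u))
  substitution (conv D P c) Δ refl ⊢u =
    conv (substitution D Δ refl ⊢u) (substitution P Δ refl ⊢u) (≈-subst _ c)

  context-legal : ∀ {Γ t T} → Γ ⊢ t ∶ T → Γ ⊢ srt ⋆ ∶ srt □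
  context-legal ax           = ax
  context-legal (symb _)     = ax
  context-legal (var P)      = weak (context-legal P) P
  context-legal (weak D P)   = weak (context-legal D) P
  context-legal (prod P _)   = context-legal P
  context-legal (abs _ P)    = context-legal P
  context-legal (appT D _)   = context-legal D
  context-legal (conv D _ _) = context-legal D

  pi-inversion : ∀ {Γ t T sx U V} → Γ ⊢ t ∶ T → t ≡ pi sx U V → ∃ λ s → (sx , U) ∷ Γ ⊢ V ∶ srt s
  pi-inversion (prod {s' = s′} _ Q) refl = s′ , Q
  pi-inversion (weak {t = pi s A B} D P) refl with pi-inversion D refl
  ... | s′ , Q = s′ , weakening Q ((s , A) ∷ []) refl P
  pi-inversion (weak {t = srt _} _ _) ()
  pi-inversion (weak {t = var _} _ _) ()
  pi-inversion (weak {t = sym _} _ _) ()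
  pi-inversion (weak {t = lam _ _ _} _ _) ()
  pi-inversion (weak {t = app _ _} _ _) ()
  pi-inversion (conv D _ _) e = pi-inversion D e
  pi-inversion ax ()
  pi-inversion (symb _) ()
  pi-inversion (var _) ()
  pi-inversion (abs _ _) ()
  pi-inversion (appT _ _) ()

  type-correctness : ∀ {Γ t T} → Γ ⊢ t ∶ T → T ≡ srt □ ⊎ ∃ λ s → Γ ⊢ T ∶ srt s
  type-correctness ax                    = inj₁ refl
  type-correctness (symb {f = f} P)      = inj₂ (sf f , P)
  type-correctness (var {sx = sx} P)     = inj₂ (sx , weak P P)
  type-correctness (weak D P) with type-correctness D
  ... | inj₁ refl    = inj₁ refl
  ... | inj₂ (s , Q) = inj₂ (s , weak Q P)
  type-correctness (prod {s' = ⋆} P _)   = inj₂ (□ , context-legal P)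
  type-correctness (prod {s' = □} _ _)   = inj₁ refl
  type-correctness (abs {s = s} _ P)     = inj₂ (s , P)
  type-correctness (appT {u = u} {V = V} D E) with type-correctness D
  ... | inj₁ ()
  ... | inj₂ (_ , P) with pi-inversion P refl
  ... | s′ , Q = inj₂ (s′ , ⊢-cast ([]-as-subst V u) refl (substitution Q [] refl E))
  type-correctness (conv {s' = s′} _ P _) = inj₂ (s′ , P)

module ConvβR⇒Convβ∪R {Sym : Set} (τ : Sym → Term Sym) (sf : Sym → Sort) (R : Term Sym → Term Sym → Set)
  (wf : WellFormedRules τ R)
  (sr′ : ∀ Γ t T t′ → Typing τ sf (Convβ∪R R) Γ t T → R ⊢ t →βR t′ → Typing τ sf (Convβ∪R R) Γ t′ T) where

  open TypingLemmas τ sf (Convβ∪R R) (Convβ∪R-subst R) using (type-correctness) renaming (_⊢_∶_ to _⊢′_∶_)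

  infix 4 _⊢_∶_
  _⊢_∶_ : Ctx {Sym} → Term Sym → Term Sym → Set
  Γ ⊢ t ∶ T = Typing τ sf (ConvβR R) Γ t T

  _↠_ : Term Sym → Term Sym → Set
  _↠_ = Star (R ⊢_→βR_)

  conv-along-↠ : ∀ {Γ t A V s} → Γ ⊢′ t ∶ A → Γ ⊢′ A ∶ srt s → A ↠ V → Γ ⊢′ t ∶ V
  conv-along-↠ ⊢t ⊢A ε = ⊢t
  conv-along-↠ {Γ} {s = s} ⊢t ⊢A (_◅_ {j = A₁} st A₁↠V) =
    conv-along-↠ (conv ⊢t ⊢A₁ (→βR⇒Convβ∪R R st)) ⊢A₁ A₁↠V
    where
    ⊢A₁ : Γ ⊢′ A₁ ∶ srt s
    ⊢A₁ = sr′ _ _ _ _ ⊢A st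

  conv-against-↠ : ∀ {Γ t A A′ s} → Γ ⊢′ t ∶ A → A′ ↠ A → Γ ⊢′ A′ ∶ srt s → Γ ⊢′ t ∶ A′
  conv-against-↠ ⊢t ε           ⊢A′ = ⊢t
  conv-against-↠ ⊢t (st ◅ A₁↠A) ⊢A′ =
    conv (conv-against-↠ ⊢t A₁↠A (sr′ _ _ _ _ ⊢A′ st)) ⊢A′ (Convβ∪R-sym R (→βR⇒Convβ∪R R st))

  conv-joinable : ∀ {Γ t T T′ s} → Γ ⊢′ t ∶ T → Γ ⊢′ T′ ∶ srt s → ConvβR R T T′ → Γ ⊢′ t ∶ T′
  conv-joinable ⊢t ⊢T′ (V , T↠V , T′↠V) with type-correctness ⊢t
  ... | inj₂ (_ , ⊢T) = conv-against-↠ (conv-along-↠ ⊢t ⊢T T↠V) T′↠V ⊢T′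
  ... | inj₁ refl     = conv-against-↠ ⊢t (≡.subst (_ ↠_) (sort-↠ R wf T↠V) T′↠V) ⊢T′

  ⊢⇒⊢′ : ∀ {Γ t T} → Γ ⊢ t ∶ T → Γ ⊢′ t ∶ T
  ⊢⇒⊢′ ax           = ax
  ⊢⇒⊢′ (symb P)     = symb (⊢⇒⊢′ P)
  ⊢⇒⊢′ (var P)      = var (⊢⇒⊢′ P)
  ⊢⇒⊢′ (weak D P)   = weak (⊢⇒⊢′ D) (⊢⇒⊢′ P)
  ⊢⇒⊢′ (prod P Q)   = prod (⊢⇒⊢′ P) (⊢⇒⊢′ Q)
  ⊢⇒⊢′ (abs D P)    = abs (⊢⇒⊢′ D) (⊢⇒⊢′ P)
  ⊢⇒⊢′ (appT D E)   = appT (⊢⇒⊢′ D) (⊢⇒⊢′ E)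
  ⊢⇒⊢′ (conv D P c) = conv-joinable (⊢⇒⊢′ D) (⊢⇒⊢′ P) c

mainTheorem4 : (Sym : Set) → (Sym ↣ ℕ)
    → (τ : Sym → Term Sym) → (sf : Sym → Sort)
    → (R : Term Sym → Term Sym → Set)
    → (∀ f → Closed (τ f))
    → (∀ f → Typing τ sf (ConvβR R) [] (τ f) (srt (sf f)))
    → (∀ f → Typing τ sf (Convβ∪R R) [] (τ f) (srt (sf f)))
    → WellFormedRules τ R
    → (∀ Γ t T t' → Typing τ sf (Convβ∪R R) Γ t T → R ⊢ t →βR t'
         → Typing τ sf (Convβ∪R R) Γ t' T)
    → (∀ Γ t T → Typing τ sf (ConvβR R) Γ t T ⇔ Typing τ sf (Convβ∪R R) Γ t T)
      × (∀ Γ t T t' → Typing τ sf (ConvβR R) Γ t T → R ⊢ t →βR t'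
         → Typing τ sf (ConvβR R) Γ t' T)
mainTheorem4 Sym _ τ sf R _ _ _ wf sr′ =
  (λ Γ t T → mk⇔ ⊢⇒⊢′ ⊢′⇒⊢) ,
  (λ Γ t T t′ ⊢t t→t′ → ⊢′⇒⊢ (sr′ Γ t T t′ (⊢⇒⊢′ ⊢t) t→t′))
  where
  open ConvβR⇒Convβ∪R τ sf R wf sr′
  ⊢′⇒⊢ : ∀ {Γ t T} → Typing τ sf (Convβ∪R R) Γ t T → Typing τ sf (ConvβR R) Γ t T
  ⊢′⇒⊢ = Typing-map (Convβ∪R⇒ConvβR R)
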